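{- Let $r,d$ be positive integers, $1\le k\le r$, and $r+1\le j_{k+1}<j_{k+2}<\dots<j_r\le rd$. Then the $r$-uniform hypergraph $\Gamma_{k,r}(j_{k+1},\dots,j_r)$ is leaf-equivalent to the empty $r$-uniform hypergraph. Moreover, the leaf-equivalence can be achieved using only $(r-1)$-faces of the form $(i_1,\dots,\widehat{i_s},\dots,i_k,j_{k+1},\dots,j_r)$, i.e. faces containing all of $j_{k+1},\dots,j_r$: there is a chain $\emptyset=\Delta_0\subset\Delta_1\subset\dots\subset\Delta_n=\Gamma_{k,r}(j_{k+1},\dots,j_r)$ with $\Delta_{i-1}=\Delta_i\setminus\{\tau_i\}$, where each $\tau_i$ has an $(r-1)$-face containing $\{j_{k+1},\dots,j_r\}$ that lies in no other hyperedge of $\Delta_i$.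
   Context: For $1\leq a\leq d$ let $S_a=\{ra-(r-1),\dots,ra\}$; in particular $S_1=\{1,\dots,r\}$. $\Omega_1^{(r,d)}$ is the $r$-uniform hypergraph with vertex set $\{1,\dots,rd\}$ whose hyperedges are the $(i_1,\dots,i_r)$ with $1\leq i_1<\dots<i_r\leq rd$ such that for some $1\leq t\leq r$, $i_1+\dots+i_r\equiv t-1\pmod r$ and $i_t\in S_1$. $\Gamma_{k,r}(j_{k+1},\dots,j_r)$ is the sub-hypergraph of $\Omega_1^{(r,d)}$ with vertex set $\{1,\dots,rd\}$ whose hyperedges are the hyperedges $(i_1,\dots,i_k,j_{k+1},\dots,j_r)$ of $\Omega_1^{(r,d)}$ with $1\le i_1<\dots<i_k\le r$. For an $r$-uniform hypergraph $\Gamma$ and $\sigma\in E(\Gamma)$: if some $(r-1)$-element subset of $\sigma$ is contained in no other hyperedge of $\Gamma$, then $\Gamma$ and $\Gamma\setminus\{\sigma\}$ are leaf-equivalent (via that face). $\Gamma$ on vertex set $V$ is leaf-equivalent to the empty $r$-uniform hypergraph if there is a chain $\emptyset=\Gamma_0\subset\dots\subset\Gamma_n=\Gamma$ of $r$-uniform hypergraphs on $V$ with $\Gamma_{i-1}=\Gamma_i\setminus\{\sigma_i\}$ leaf-equivalent to $\Gamma_i$ for each $i$. -}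

module Defs where

open import Data.Nat using (ℕ; _+_; _*_; _≤_; _<_)
open import Data.Fin using (Fin; toℕ)
open import Data.Nat.ListAction using (sum)
open import Data.List using (List; []; _∷_; length; lookup; removeAt; _++_)
open import Data.List.Relation.Unary.All using (All)
open import Data.List.Relation.Unary.Linked using (Linked)
open import Data.List.Membership.Propositional using (_∈_)
open import Data.List.Relation.Binary.Subset.Propositional using (_⊆_)
open import Data.Product using (Σ; _×_)
open import Relation.Binary.PropositionalEquality using (_≡_)

-- Hyperedges are represented as strictly increasing lists (i_1 < ... < i_r)
-- of vertices; an r-uniform hypergraph is a finite list of such hyperedges.

-- (i_1,...,i_r) is a hyperedge of Ω_1^{(r,d)}: 1 ≤ i_1 < ... < i_r ≤ rd and
-- for some 1 ≤ t ≤ r (here t-1 = toℕ t'), i_1+...+i_r ≡ t-1 (mod r)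
-- (written as ∃ q. sum = q*r + (t-1), with 0 ≤ t-1 < r) and i_t ∈ S_1 = {1..r}.
OmegaEdge : ℕ → ℕ → List ℕ → Set
OmegaEdge r d τ =
  (length τ ≡ r) × Linked _<_ τ × All (λ i → 1 ≤ i × i ≤ r * d) τ ×
  Σ (Fin (length τ)) (λ t →
     Σ ℕ (λ q → sum τ ≡ q * r + toℕ t) × (1 ≤ lookup τ t × lookup τ t ≤ r))

GammaEdge : ℕ → ℕ → ℕ → List ℕ → List ℕ → Set
GammaEdge r d k js τ =
  Σ (List ℕ) (λ is →
    (length is ≡ k) × Linked _<_ is × All (λ i → 1 ≤ i × i ≤ r) is ×
    (τ ≡ is ++ js) × OmegaEdge r d τ)

FreeFace : List ℕ → List ℕ → List (List ℕ) → Set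
FreeFace js τ Δ =
  Σ (Fin (length τ)) (λ s →
    (js ⊆ removeAt τ s) ×
    (∀ {σ} → σ ∈ Δ → removeAt τ s ⊆ σ → σ ≡ τ))

-- A leaf-removal chain: the list τ_n ∷ τ_{n-1} ∷ ... ∷ τ_1 encodes
-- Δ_i = {τ_1,...,τ_i}; at each step τ_i has a free face (containing js) in Δ_i,
-- and Δ_{i-1} = Δ_i \ {τ_i}.
data LeafChain (js : List ℕ) : List (List ℕ) → Set where
  []  : LeafChain js []
  _∷_ : ∀ {τ Δ} → FreeFace js τ (τ ∷ Δ) → LeafChain js Δ → LeafChain js (τ ∷ Δ)

module Submission where

-- For τ = I ++ js the residue t = (Σ τ) mod r is the 0-based position of the vertex i_{t+1}
-- that must lie in S_1, so τ is a hyperedge of Γ iff t < k, and dropping that vertex gives the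
-- free face used for τ. The admissible sets I ⊆ (a, r] are listed by recursion on the smallest
-- candidate a + 1: first the sets avoiding a + 1, then those through a + 1 with residue 0 (whose
-- face is I minus a + 1, and a k-set through a + 1 is determined by that face), then the other sets
-- through a + 1, whose residue is one more than that of their tail, so their faces keep a + 1 and
-- the argument recurses. A face of a set avoiding a + 1 never lies in a later set through a + 1:
-- trading its dropped vertex x for a + 1 lowers the sum by x − a − 1, which moves the residue
-- past k. Hence no face lies in a later set, and removing the edges in this order is a leaf chain.

open import Defs
open import Data.Nat using (ℕ; zero; suc; _+_; _*_; _∸_; _≤_; _<_; s≤s; s≤s⁻¹; z<s; _≟_; _<?_; NonZero; >-nonZero⁻¹)
open import Data.Nat.Properties
open import Data.Nat.DivMod using (_%_; _/_; m≡m%n+[m/n]*n; [m+kn]%n≡m%n; [m+n]%n≡m%n; m<n⇒m%n≡m; m%n<n)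
open import Data.Nat.ListAction using (sum)
open import Data.List using (List; []; _∷_; length; _++_; map; lookup; removeAt)
open import Data.List.Relation.Unary.All as All using (All; []; _∷_)
open import Data.List.Relation.Unary.AllPairs as AllPairs using (AllPairs; []; _∷_)
open import Data.List.Relation.Unary.Linked as Linked using (Linked; []; [-]; _∷_)
open import Data.List.Relation.Unary.Linked.Properties using (Linked⇒All; Linked⇒AllPairs; AllPairs⇒Linked)
import Data.List.Relation.Unary.All.Properties as Allₚ
open import Data.List.Relation.Binary.Sublist.Heterogeneous using (Sublist; []; _∷_; _∷ʳ_; minimum)
open import Data.List.Relation.Binary.Sublist.Heterogeneous.Properties using (length-mono-≤; toPointwise)
open import Data.List.Relation.Binary.Pointwise using (Pointwise-≡⇒≡)
open import Data.List.Membership.Propositional using (_∈_)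
open import Data.List.Membership.Propositional.Properties using (∈-lookup; ∈-map⁺; ∈-map⁻; ∈-++⁺ˡ; ∈-++⁺ʳ; ∈-++⁻)
open import Data.List.Relation.Unary.Unique.Propositional using (Unique)
import Data.List.Relation.Unary.Unique.Propositional.Properties as Unique
import Data.List.Relation.Unary.AllPairs.Properties as AllPairsₚ
open import Data.List.Properties using (∷-injectiveʳ; ++-cancelʳ; length-++)
open import Data.Nat.ListAction.Properties using (sum-++)
open import Data.List.Relation.Unary.Any using (here; there)
open import Data.List.Relation.Binary.Subset.Propositional using (_⊆_)
open import Data.Fin as Fin using (Fin; toℕ)
open import Data.Fin.Properties using (toℕ<n)
open import Function.Bundles using (_⇔_; mk⇔)
open import Data.Empty using (⊥-elim)
open import Data.Product using (Σ; _×_; _,_; proj₁; proj₂; map₁)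
open import Data.Sum using (_⊎_; inj₁; inj₂)
open import Relation.Nullary using (¬_; Dec; yes; no)
open import Data.Nat.Tactic.RingSolver using (solve-∀)
open import Relation.Binary.PropositionalEquality

Increasing : List ℕ → Set
Increasing = Linked _<_

Increasing⇒All : ∀ {a I} → Increasing (a ∷ I) → All (a <_) I
Increasing⇒All [-] = []
Increasing⇒All (a<x ∷ I↑) = Linked⇒All <-trans a<x I↑

All⇒Increasing : ∀ {a I} → All (a <_) I → Increasing I → Increasing (a ∷ I)
All⇒Increasing [] _ = [-]
All⇒Increasing (a<x ∷ _) I↑ = a<x ∷ I↑

∈-∷⁻ : ∀ {x y : ℕ} {ys} → x ∈ y ∷ ys → x ≢ y → x ∈ ys
∈-∷⁻ (here x≡y) x≢y = ⊥-elim (x≢y x≡y)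
∈-∷⁻ (there x∈ys) _ = x∈ys

⊆-∷⁻ : ∀ {a xs ys} → All (a <_) xs → xs ⊆ a ∷ ys → xs ⊆ ys
⊆-∷⁻ a<xs xs⊆ x∈xs = ∈-∷⁻ (xs⊆ x∈xs) λ { refl → <-irrefl refl (All.lookup a<xs x∈xs) }

Increasing-⊆⇒Sublist : ∀ {xs ys} → Increasing xs → Increasing ys → xs ⊆ ys → Sublist _≡_ xs ys
Increasing-⊆⇒Sublist {[]} {ys} _ _ _ = minimum ys
Increasing-⊆⇒Sublist {x ∷ xs} {[]} _ _ xs⊆ with xs⊆ (here refl)
... | ()
Increasing-⊆⇒Sublist {x ∷ xs} {y ∷ ys} xs↑ ys↑ xs⊆ with x ≟ y
... | yes refl = refl ∷ Increasing-⊆⇒Sublist (Linked.tail xs↑) (Linked.tail ys↑)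
                   (⊆-∷⁻ (Increasing⇒All xs↑) (λ z∈xs → xs⊆ (there z∈xs)))
... | no x≢y = y ∷ʳ Increasing-⊆⇒Sublist xs↑ (Linked.tail ys↑) (⊆-∷⁻ y<xs xs⊆)
  where
  y<x : y < x
  y<x = All.lookup (Increasing⇒All ys↑) (∈-∷⁻ (xs⊆ (here refl)) x≢y)
  y<xs : All (y <_) (x ∷ xs)
  y<xs = Linked⇒All <-trans y<x xs↑

Increasing-⊆-≡ : ∀ {xs ys} → Increasing xs → Increasing ys → xs ⊆ ys → length ys ≤ length xs → xs ≡ ys
Increasing-⊆-≡ xs↑ ys↑ xs⊆ys |ys|≤|xs| =
  Pointwise-≡⇒≡ (toPointwise (≤-antisym (length-mono-≤ xs⊑ys) |ys|≤|xs|) xs⊑ys)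
  where xs⊑ys = Increasing-⊆⇒Sublist xs↑ ys↑ xs⊆ys

deleteAt : ℕ → List ℕ → List ℕ
deleteAt _ [] = []
deleteAt zero (x ∷ xs) = xs
deleteAt (suc t) (x ∷ xs) = x ∷ deleteAt t xs

elemAt : ℕ → List ℕ → ℕ
elemAt _ [] = 0
elemAt zero (x ∷ xs) = x
elemAt (suc t) (x ∷ xs) = elemAt t xs

deleteAt-⊆ : ∀ t xs → deleteAt t xs ⊆ xs
deleteAt-⊆ t [] = λ ()
deleteAt-⊆ zero (x ∷ xs) = there
deleteAt-⊆ (suc t) (x ∷ xs) (here y≡x) = here y≡x
deleteAt-⊆ (suc t) (x ∷ xs) (there y∈) = there (deleteAt-⊆ t xs y∈)

elemAt-∈ : ∀ t xs → t < length xs → elemAt t xs ∈ xs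
elemAt-∈ zero (x ∷ xs) _ = here refl
elemAt-∈ (suc t) (x ∷ xs) (s≤s t<) = there (elemAt-∈ t xs t<)

length-deleteAt : ∀ t xs → t < length xs → suc (length (deleteAt t xs)) ≡ length xs
length-deleteAt zero (x ∷ xs) _ = refl
length-deleteAt (suc t) (x ∷ xs) (s≤s t<) = cong suc (length-deleteAt t xs t<)

sum-deleteAt : ∀ t xs → t < length xs → sum (deleteAt t xs) + elemAt t xs ≡ sum xs
sum-deleteAt zero (x ∷ xs) _ = +-comm (sum xs) x
sum-deleteAt (suc t) (x ∷ xs) (s≤s t<) =
  trans (+-assoc x _ _) (cong (x +_) (sum-deleteAt t xs t<))

deleteAt⁺ : ∀ t {xs} → Increasing xs → Increasing (deleteAt t xs)
deleteAt⁺ _ [] = []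
deleteAt⁺ zero [-] = []
deleteAt⁺ zero (_ ∷ ys↑) = ys↑
deleteAt⁺ (suc t) [-] = [-]
deleteAt⁺ (suc zero) (x<y ∷ ys↑) = All⇒Increasing (All.tail (Linked⇒All <-trans x<y ys↑)) (Linked.tail ys↑)
deleteAt⁺ (suc (suc t)) (x<y ∷ ys↑) = x<y ∷ deleteAt⁺ (suc t) ys↑

elemAt-lower : ∀ t {a xs} → Increasing (a ∷ xs) → t < length xs → t + a < elemAt t xs
elemAt-lower zero {xs = _ ∷ _} (a<x ∷ _) _ = a<x
elemAt-lower (suc t) {xs = x ∷ _ ∷ _} (a<x ∷ xs↑) (s≤s t<) = ≤-<-trans (+-monoʳ-< t a<x) (elemAt-lower t xs↑ t<)
elemAt-lower (suc t) {xs = _ ∷ []} _ (s≤s ())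

head+length≤ : ∀ {h x xs} → Increasing (x ∷ xs) → All (_≤ h) (x ∷ xs) → x + length xs ≤ h
head+length≤ {x = x} [-] (x≤h ∷ []) = ≤-trans (≤-reflexive (+-identityʳ x)) x≤h
head+length≤ {x = x} {y ∷ ys} (x<y ∷ ys↑) (_ ∷ ys≤h) =
  ≤-trans (≤-reflexive (+-suc x (length ys))) (≤-trans (+-monoˡ-≤ (length ys) x<y) (head+length≤ ys↑ ys≤h))

elemAt-upper : ∀ t {h xs} → Increasing xs → All (_≤ h) xs → t < length xs → elemAt t xs + length xs ≤ suc (t + h)
elemAt-upper zero {xs = x ∷ xs} xs↑ xs≤h _ = ≤-trans (≤-reflexive (+-suc x (length xs))) (s≤s (head+length≤ xs↑ xs≤h))
elemAt-upper (suc t) {xs = x ∷ xs} xs↑ (_ ∷ xs≤h) (s≤s t<) =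
  ≤-trans (≤-reflexive (+-suc (elemAt t xs) (length xs))) (s≤s (elemAt-upper t (Linked.tail xs↑) xs≤h t<))

index++ : ∀ (xs ys : List ℕ) t → t < length xs → Fin (length (xs ++ ys))
index++ (x ∷ xs) ys zero _ = Fin.zero
index++ (x ∷ xs) ys (suc t) (s≤s t<) = Fin.suc (index++ xs ys t t<)

toℕ-index++ : ∀ xs ys t (t< : t < length xs) → toℕ (index++ xs ys t t<) ≡ t
toℕ-index++ (x ∷ xs) ys zero _ = refl
toℕ-index++ (x ∷ xs) ys (suc t) (s≤s t<) = cong suc (toℕ-index++ xs ys t t<)

lookup-index++ : ∀ xs ys t (t< : t < length xs) → lookup (xs ++ ys) (index++ xs ys t t<) ≡ elemAt t xs
lookup-index++ (x ∷ xs) ys zero _ = refl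
lookup-index++ (x ∷ xs) ys (suc t) (s≤s t<) = lookup-index++ xs ys t t<

removeAt-index++ : ∀ xs ys t (t< : t < length xs) → removeAt (xs ++ ys) (index++ xs ys t t<) ≡ deleteAt t xs ++ ys
removeAt-index++ (x ∷ xs) ys zero _ = refl
removeAt-index++ (x ∷ xs) ys (suc t) (s≤s t<) = cong (x ∷_) (removeAt-index++ xs ys t t<)

index++-split : ∀ (xs ys : List ℕ) (i : Fin (length (xs ++ ys))) → toℕ i < length xs ⊎ lookup (xs ++ ys) i ∈ ys
index++-split [] ys i = inj₂ (∈-lookup i)
index++-split (x ∷ xs) ys Fin.zero = inj₁ z<s
index++-split (x ∷ xs) ys (Fin.suc i) with index++-split xs ys i
... | inj₁ i<|xs| = inj₁ (s≤s i<|xs|)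
... | inj₂ i∈ys = inj₂ i∈ys

%-+-carry : ∀ m n d .{{_ : NonZero d}} → n ≤ d →
            m % d + n ≡ (m + n) % d ⊎ m % d + n ≡ (m + n) % d + d
%-+-carry m n d n≤d = carry (s + n <? d)
  where
  s = m % d
  reduce : (m + n) % d ≡ (s + n) % d
  reduce = begin
    (m + n) % d              ≡⟨ cong (λ z → (z + n) % d) (m≡m%n+[m/n]*n m d) ⟩
    (s + m / d * d + n) % d  ≡⟨ cong (_% d) (+-right-comm s (m / d * d) n) ⟩
    (s + n + m / d * d) % d  ≡⟨ [m+kn]%n≡m%n (s + n) (m / d) d ⟩
    (s + n) % d              ∎
    where
    open ≡-Reasoning
    +-right-comm : ∀ a b c → a + b + c ≡ a + c + b
    +-right-comm = solve-∀
  carry : Dec (s + n < d) → s + n ≡ (m + n) % d ⊎ s + n ≡ (m + n) % d + d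
  carry (yes s+n<d) = inj₁ (sym (trans reduce (m<n⇒m%n≡m s+n<d)))
  carry (no s+n≮d) = inj₂ (trans (sym (m∸n+n≡m d≤s+n)) (cong (_+ d) w≡[m+n]%d))
    where
    d≤s+n = ≮⇒≥ s+n≮d
    w = s + n ∸ d
    w<d : w < d
    w<d = +-cancelʳ-< d w d (subst (_< d + d) (sym (m∸n+n≡m d≤s+n)) (+-mono-<-≤ (m%n<n m d) n≤d))
    w≡[m+n]%d : w ≡ (m + n) % d
    w≡[m+n]%d = sym (begin
      (m + n) % d   ≡⟨ reduce ⟩
      (s + n) % d   ≡⟨ cong (_% d) (sym (m∸n+n≡m d≤s+n)) ⟩
      (w + d) % d   ≡⟨ [m+n]%n≡m%n w d ⟩
      w % d         ≡⟨ m<n⇒m%n≡m w<d ⟩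
      w             ∎)
      where open ≡-Reasoning

%-suc-carry : ∀ m d .{{_ : NonZero d}} → suc m % d ≡ suc (m % d) ⊎ suc m % d + d ≡ suc (m % d)
%-suc-carry m d rewrite +-comm 1 (m % d) | sym (+-comm m 1) with %-+-carry m 1 d (>-nonZero⁻¹ d)
... | inj₁ [m%d]+1≡ = inj₁ (sym [m%d]+1≡)
... | inj₂ [m%d]+1≡ = inj₂ (sym [m%d]+1≡)

%-suc : ∀ m d .{{_ : NonZero d}} → suc m % d ≡ 0 ⊎ suc m % d ≡ suc (m % d)
%-suc m d with %-suc-carry m d
... | inj₁ 1+m%d≡ = inj₂ 1+m%d≡
... | inj₂ 1+m%d+d≡ = inj₁ (n≤0⇒n≡0 (+-cancelʳ-≤ d _ 0 (≤-trans (≤-reflexive 1+m%d+d≡) (m%n<n m d))))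

%-suc-< : ∀ m d .{{_ : NonZero d}} → suc (m % d) < d → suc m % d ≡ suc (m % d)
%-suc-< m d 1+m%d<d with %-suc-carry m d
... | inj₁ 1+m%d≡ = 1+m%d≡
... | inj₂ 1+m%d+d≡ = ⊥-elim (<⇒≱ 1+m%d<d (≤-trans (m≤n+m d _) (≤-reflexive 1+m%d+d≡)))

%-+-wrap : ∀ m n k d .{{_ : NonZero d}} → n ≤ d → (m + n) % d < n → n + k < (m + n) % d + d → k < m % d
%-+-wrap m n k d n≤d t<n n+k<t+d with %-+-carry m n d n≤d
... | inj₁ m%d+n≡t = ⊥-elim (<⇒≱ t<n (≤-trans (m≤n+m n (m % d)) (≤-reflexive m%d+n≡t)))
... | inj₂ m%d+n≡t+d =
  +-cancelˡ-< n k (m % d) (<-≤-trans n+k<t+d (≤-reflexive (trans (sym m%d+n≡t+d) (+-comm (m % d) n))))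

AllPairs-map-∈ : ∀ {A : Set} {R S : A → A → Set} {xs} →
                 (∀ {x y} → x ∈ xs → y ∈ xs → R x y → S x y) → AllPairs R xs → AllPairs S xs
AllPairs-map-∈ {xs = []} _ [] = []
AllPairs-map-∈ {xs = x ∷ xs} f (Rx ∷ Rxs) =
  All.tabulate (λ y∈ → f (here refl) (there y∈) (All.lookup Rx y∈)) ∷
  AllPairs-map-∈ (λ x∈ y∈ → f (there x∈) (there y∈)) Rxs

KSubset : ℕ → ℕ → ℕ → List ℕ → Set
KSubset k a n I = Increasing (a ∷ I) × All (_≤ a + n) I × length I ≡ k

KSubset-widen : ∀ {k a n I} → KSubset k (suc a) n I → KSubset k a (suc n) I
KSubset-widen {a = a} {n} {I} (I↑ , I≤ , |I|) = lower I↑ , subst (λ h → All (_≤ h) I) (sym (+-suc a n)) I≤ , |I|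
  where
  lower : ∀ {I} → Increasing (suc a ∷ I) → Increasing (a ∷ I)
  lower [-] = [-]
  lower (1+a<x ∷ I↑) = <⇒≤ 1+a<x ∷ I↑

KSubset-∷ : ∀ {k a n I} → KSubset k (suc a) n I → KSubset (suc k) a (suc n) (suc a ∷ I)
KSubset-∷ {a = a} {n} {I} (I↑ , I≤ , |I|) =
  n<1+n a ∷ I↑ , subst (λ h → All (_≤ h) (suc a ∷ I)) (sym (+-suc a n)) (m≤m+n (suc a) n ∷ I≤) , cong suc |I|

KSubset-tail : ∀ {k a n I} → KSubset (suc k) a (suc n) (suc a ∷ I) → KSubset k (suc a) n I
KSubset-tail {a = a} {n} {I} (I↑ , _ ∷ I≤ , |I|) =
  Linked.tail I↑ , subst (λ h → All (_≤ h) I) (+-suc a n) I≤ , suc-injective |I|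

KSubset-narrow : ∀ {k a n x I} → KSubset k a (suc n) (x ∷ I) → x ≢ suc a → KSubset k (suc a) n (x ∷ I)
KSubset-narrow {a = a} {n} {x} {I} (a<x ∷ I↑ , I≤ , |I|) x≢1+a =
  ≤∧≢⇒< a<x (λ 1+a≡x → x≢1+a (sym 1+a≡x)) ∷ I↑ , subst (λ h → All (_≤ h) (x ∷ I)) (+-suc a n) I≤ , |I|

KSubset-empty : ∀ {k a x I} → ¬ KSubset k a 0 (x ∷ I)
KSubset-empty {a = a} (a<x ∷ _ , x≤a+0 ∷ _ , _) =
  <-irrefl refl (<-≤-trans a<x (≤-trans x≤a+0 (≤-reflexive (+-identityʳ a))))

KSubset-∌floor : ∀ {k a n I} → ¬ KSubset k a n (a ∷ I)
KSubset-∌floor (a<a ∷ _ , _) = <-irrefl refl a<a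

module Shelling (r : ℕ) .{{_ : NonZero r}} where

  residue : ℕ → List ℕ → ℕ
  residue c I = (sum I + c) % r

  face : ℕ → List ℕ → List ℕ
  face c I = deleteAt (residue c I) I

  FaceAvoids : ℕ → List ℕ → List ℕ → Set
  FaceAvoids c I J = ¬ face c I ⊆ J

  ZeroResidue : ℕ → ℕ → ℕ → ℕ → List ℕ → Set
  ZeroResidue k c a n I = KSubset k a n I × residue c I ≡ 0

  -- With c = Σ js, I ++ js is a hyperedge of Γ exactly when I ⊆ {1..r} is admissible.
  Admissible : ℕ → ℕ → ℕ → ℕ → List ℕ → Set
  Admissible k c a n I = KSubset k a n I × residue c I < k

  residue-∷ : ∀ c x I → residue c (x ∷ I) ≡ residue (c + x) I
  residue-∷ c x I = cong (_% r) (rearrange x (sum I) c)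
    where
    rearrange : ∀ x s c → x + s + c ≡ s + (c + x)
    rearrange = solve-∀

  residue-∷-suc : ∀ c a I → residue c (suc a ∷ I) ≡ suc (sum I + (c + a)) % r
  residue-∷-suc c a I = cong (_% r) (rearrange a (sum I) c)
    where
    rearrange : ∀ a s c → suc a + s + c ≡ suc (s + (c + a))
    rearrange = solve-∀

  residue-∷-cases : ∀ c a I → residue c (suc a ∷ I) ≡ 0 ⊎ residue c (suc a ∷ I) ≡ suc (residue (c + a) I)
  residue-∷-cases c a I rewrite residue-∷-suc c a I = %-suc (sum I + (c + a)) r

  residue-∷-< : ∀ {k} c a I → suc k ≤ r → residue (c + a) I < k → residue c (suc a ∷ I) ≡ suc (residue (c + a) I)
  residue-∷-< c a I 1+k≤r res<k =
    trans (residue-∷-suc c a I) (%-suc-< (sum I + (c + a)) r (<-≤-trans (s≤s res<k) 1+k≤r))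

  zeroResidueSets : ℕ → ℕ → ℕ → ℕ → List (List ℕ)
  zeroResidueSets zero c a n with c % r ≟ 0
  ... | yes _ = [] ∷ []
  ... | no _ = []
  zeroResidueSets (suc k) c a zero = []
  zeroResidueSets (suc k) c a (suc n) =
    zeroResidueSets (suc k) c (suc a) n ++ map (suc a ∷_) (zeroResidueSets k (c + suc a) (suc a) n)

  -- The order of the three blocks is the removal order. In the last block the free face shifts
  -- one position to the right, which the offset c + a (rather than c + suc a) accounts for.
  admissibleSets : ℕ → ℕ → ℕ → ℕ → List (List ℕ)
  admissibleSets zero c a n = []
  admissibleSets (suc k) c a zero = []
  admissibleSets (suc k) c a (suc n) =
    admissibleSets (suc k) c (suc a) n ++
    map (suc a ∷_) (zeroResidueSets k (c + suc a) (suc a) n ++ admissibleSets k (c + a) (suc a) n)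

  ∈-zeroResidueSets⁻ : ∀ k c a n {I} → I ∈ zeroResidueSets k c a n → ZeroResidue k c a n I
  ∈-zeroResidueSets⁻ zero c a n I∈ with c % r ≟ 0
  ∈-zeroResidueSets⁻ zero c a n (here refl) | yes c%r≡0 = ([-] , [] , refl) , c%r≡0
  ∈-zeroResidueSets⁻ (suc k) c a (suc n) I∈ with ∈-++⁻ (zeroResidueSets (suc k) c (suc a) n) I∈
  ... | inj₁ I∈₁ = map₁ KSubset-widen (∈-zeroResidueSets⁻ (suc k) c (suc a) n I∈₁)
  ... | inj₂ I∈₂ with ∈-map⁻ (suc a ∷_) I∈₂
  ... | J , J∈ , refl with ∈-zeroResidueSets⁻ k (c + suc a) (suc a) n J∈
  ... | J⊂ , res≡0 = KSubset-∷ J⊂ , trans (residue-∷ c (suc a) J) res≡0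

  ∈-zeroResidueSets⁺ : ∀ k c a n {I} → ZeroResidue k c a n I → I ∈ zeroResidueSets k c a n
  ∈-zeroResidueSets⁺ zero c a n {[]} (_ , c%r≡0) with c % r ≟ 0
  ... | yes _ = here refl
  ... | no c%r≢0 = ⊥-elim (c%r≢0 c%r≡0)
  ∈-zeroResidueSets⁺ (suc k) c a zero {x ∷ I} (I⊂ , _) = ⊥-elim (KSubset-empty I⊂)
  ∈-zeroResidueSets⁺ (suc k) c a (suc n) {x ∷ I} (I⊂ , res≡0) with x ≟ suc a
  ... | yes refl = ∈-++⁺ʳ (zeroResidueSets (suc k) c (suc a) n)
                     (∈-map⁺ (suc a ∷_) (∈-zeroResidueSets⁺ k (c + suc a) (suc a) n
                       (KSubset-tail I⊂ , trans (sym (residue-∷ c (suc a) I)) res≡0)))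
  ... | no x≢1+a = ∈-++⁺ˡ (∈-zeroResidueSets⁺ (suc k) c (suc a) n (KSubset-narrow I⊂ x≢1+a , res≡0))

  zeroResidueSets-unique : ∀ k c a n → Unique (zeroResidueSets k c a n)
  zeroResidueSets-unique zero c a n with c % r ≟ 0
  ... | yes _ = [] ∷ []
  ... | no _ = []
  zeroResidueSets-unique (suc k) c a zero = []
  zeroResidueSets-unique (suc k) c a (suc n) =
    Unique.++⁺ (zeroResidueSets-unique (suc k) c (suc a) n)
               (Unique.map⁺ ∷-injectiveʳ (zeroResidueSets-unique k (c + suc a) (suc a) n))
               disjoint
    where
    disjoint : ∀ {I} → ¬ (I ∈ zeroResidueSets (suc k) c (suc a) n × I ∈ map (suc a ∷_) _)
    disjoint (I∈₁ , I∈₂) with ∈-map⁻ (suc a ∷_) I∈₂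
    ... | _ , _ , refl = KSubset-∌floor (proj₁ (∈-zeroResidueSets⁻ (suc k) c (suc a) n I∈₁))

  ∈-admissibleSets⁻ : ∀ k c a n {I} → k ≤ r → I ∈ admissibleSets k c a n → Admissible k c a n I
  ∈-admissibleSets⁻ (suc k) c a (suc n) k<r I∈ with ∈-++⁻ (admissibleSets (suc k) c (suc a) n) I∈
  ... | inj₁ I∈₁ = map₁ KSubset-widen (∈-admissibleSets⁻ (suc k) c (suc a) n k<r I∈₁)
  ... | inj₂ I∈₂ with ∈-map⁻ (suc a ∷_) I∈₂
  ... | J , J∈ , refl with ∈-++⁻ (zeroResidueSets k (c + suc a) (suc a) n) J∈
  ... | inj₁ J∈₁ = let J⊂ , res≡0 = ∈-zeroResidueSets⁻ k (c + suc a) (suc a) n J∈₁ in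
    KSubset-∷ J⊂ , subst (_< suc k) (sym (trans (residue-∷ c (suc a) J) res≡0)) z<s
  ... | inj₂ J∈₂ = let J⊂ , res<k = ∈-admissibleSets⁻ k (c + a) (suc a) n (<⇒≤ k<r) J∈₂ in
    KSubset-∷ J⊂ , subst (_< suc k) (sym (residue-∷-< c a J k<r res<k)) (s≤s res<k)

  ∈-admissibleSets⁺ : ∀ k c a n {I} → Admissible k c a n I → I ∈ admissibleSets k c a n
  ∈-admissibleSets⁺ (suc k) c a zero {x ∷ I} (I⊂ , _) = ⊥-elim (KSubset-empty I⊂)
  ∈-admissibleSets⁺ (suc k) c a (suc n) {x ∷ I} (I⊂ , res<) with x ≟ suc a
  ... | no x≢1+a = ∈-++⁺ˡ (∈-admissibleSets⁺ (suc k) c (suc a) n (KSubset-narrow I⊂ x≢1+a , res<))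
  ... | yes refl = ∈-++⁺ʳ (admissibleSets (suc k) c (suc a) n) (∈-map⁺ (suc a ∷_) I∈)
    where
    I∈ : I ∈ zeroResidueSets k (c + suc a) (suc a) n ++ admissibleSets k (c + a) (suc a) n
    I∈ with residue-∷-cases c a I
    ... | inj₁ res≡0 = ∈-++⁺ˡ (∈-zeroResidueSets⁺ k (c + suc a) (suc a) n
                         (KSubset-tail I⊂ , trans (sym (residue-∷ c (suc a) I)) res≡0))
    ... | inj₂ res≡1+ = ∈-++⁺ʳ (zeroResidueSets k (c + suc a) (suc a) n) (∈-admissibleSets⁺ k (c + a) (suc a) n
                         (KSubset-tail I⊂ , s≤s⁻¹ (subst (_< suc k) res≡1+ res<)))

  FaceAvoids⇒≢ : ∀ {c I J} → FaceAvoids c I J → I ≢ J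
  FaceAvoids⇒≢ {I = I} avoids refl = avoids (deleteAt-⊆ _ I)

  face-⊆-∷⁻ : ∀ {c a I J} → Increasing (a ∷ I) → face c I ⊆ a ∷ J → face c I ⊆ J
  face-⊆-∷⁻ {c} {I = I} I↑ =
    ⊆-∷⁻ (All.tabulate (λ y∈ → All.lookup (Increasing⇒All I↑) (deleteAt-⊆ (residue c I) I y∈)))

  zeroResidue-∷-avoids : ∀ {k c a n I J} → KSubset k (suc a) n I → KSubset k (suc a) n J →
                         residue c (suc a ∷ I) ≡ 0 → I ≢ J → FaceAvoids c (suc a ∷ I) (suc a ∷ J)
  zeroResidue-∷-avoids {a = a} {I = I} (I↑ , _ , |I|) (J↑ , _ , |J|) res≡0 I≢J face⊆ =
    I≢J (Increasing-⊆-≡ (Linked.tail I↑) (Linked.tail J↑) (⊆-∷⁻ (Increasing⇒All I↑) I⊆)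
                        (≤-reflexive (trans |J| (sym |I|))))
    where
    I⊆ : I ⊆ suc a ∷ _
    I⊆ = subst (_⊆ _) (cong (λ t → deleteAt t (suc a ∷ I)) res≡0) face⊆

  admissible-∷-avoids : ∀ {k c a n I} J → suc k ≤ r → Admissible k (c + a) (suc a) n I →
                        FaceAvoids (c + a) I J → FaceAvoids c (suc a ∷ I) (suc a ∷ J)
  admissible-∷-avoids {c = c} {a} {I = I} J k<r ((I↑ , _) , res<k) avoids face⊆ =
    avoids (face-⊆-∷⁻ I↑ (λ y∈ → subst (_⊆ suc a ∷ J) face≡ face⊆ (there y∈)))
    where
    face≡ : face c (suc a ∷ I) ≡ suc a ∷ face (c + a) I
    face≡ = cong (λ t → deleteAt t (suc a ∷ I)) (residue-∷-< c a I k<r res<k)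

  admissible-crossing : ∀ {k c a n I J} → suc a + n ≤ r → Admissible (suc k) c (suc a) n I →
                        Admissible (suc k) c a (suc n) (suc a ∷ J) → FaceAvoids c I (suc a ∷ J)
  admissible-crossing {k} {c} {a} {n} {I} {J} bound ((I↑ , I≤ , |I|) , t<1+k) ((J↑ , _ , |J|) , s<1+k) face⊆ =
    <⇒≱ k<s (s≤s⁻¹ s<1+k)
    where
    t = residue c I
    m = sum (suc a ∷ J) + c
    t<|I| : t < length I
    t<|I| = subst (t <_) (sym |I|) t<1+k
    x = elemAt t I
    δ = x ∸ suc a
    t+1+a<x : t + suc a < x
    t+1+a<x = elemAt-lower t I↑ t<|I|
    δ+1+a≡x : δ + suc a ≡ x
    δ+1+a≡x = m∸n+n≡m (≤-trans (m≤n+m (suc a) t) (<⇒≤ t+1+a<x))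
    face≡J : deleteAt t I ≡ J
    face≡J = Increasing-⊆-≡ (deleteAt⁺ t (Linked.tail I↑)) (Linked.tail (Linked.tail J↑)) (face-⊆-∷⁻ I↑ face⊆)
               (≤-reflexive (suc-injective (trans |J| (sym (trans (length-deleteAt t I t<|I|) |I|)))))
    t≡ : t ≡ (m + δ) % r
    t≡ = cong (_% r) (begin
      sum I + c                   ≡⟨ cong (_+ c) (sum-deleteAt t I t<|I|) ⟨
      sum (deleteAt t I) + x + c  ≡⟨ cong₂ (λ F y → sum F + y + c) face≡J (sym δ+1+a≡x) ⟩
      sum J + (δ + suc a) + c     ≡⟨ rearrange (sum J) δ a c ⟩
      m + δ                       ∎)
      where
      open ≡-Reasoning
      rearrange : ∀ s δ a c → s + (δ + suc a) + c ≡ suc a + s + c + δ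
      rearrange = solve-∀
    t<δ : t < δ
    t<δ = +-cancelʳ-< (suc a) t δ (subst (t + suc a <_) (sym δ+1+a≡x) t+1+a<x)
    δ+k<t+r : δ + k < t + r
    δ+k<t+r = s≤s⁻¹ (begin
      suc (suc (δ + k))      ≤⟨ s≤s (s≤s (m≤m+n (δ + k) a)) ⟩
      suc (suc (δ + k + a))  ≡⟨ rearrange δ k a ⟩
      δ + suc a + suc k      ≡⟨ cong₂ _+_ δ+1+a≡x (sym |I|) ⟩
      x + length I           ≤⟨ elemAt-upper t (Linked.tail I↑) I≤ t<|I| ⟩
      suc (t + (suc a + n))  ≤⟨ s≤s (+-monoʳ-≤ t bound) ⟩
      suc (t + r)            ∎)
      where
      open ≤-Reasoning
      rearrange : ∀ δ k a → suc (suc (δ + k + a)) ≡ δ + suc a + suc k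
      rearrange = solve-∀
    δ≤r : δ ≤ r
    δ≤r = ≤-trans (m∸n≤m x (suc a)) (≤-trans (All.lookup I≤ (elemAt-∈ t I t<|I|)) bound)
    k<s : k < residue c (suc a ∷ J)
    k<s = %-+-wrap m δ k r δ≤r (subst (_< δ) t≡ t<δ) (subst (λ t → δ + k < t + r) t≡ δ+k<t+r)

  admissibleSets-shelling : ∀ k c a n → k ≤ r → a + n ≤ r → AllPairs (FaceAvoids c) (admissibleSets k c a n)
  admissibleSets-shelling zero c a n _ _ = []
  admissibleSets-shelling (suc k) c a zero _ _ = []
  admissibleSets-shelling (suc k) c a (suc n) k<r a+n≤r =
    AllPairsₚ.++⁺ (admissibleSets-shelling (suc k) c (suc a) n k<r bound)
                 (AllPairsₚ.map⁺ through-1+a)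
                 (All.tabulate λ I∈ → All.tabulate λ J∈ → crossing I∈ J∈)
    where
    bound : suc a + n ≤ r
    bound = subst (_≤ r) (+-suc a n) a+n≤r
    Z = zeroResidueSets k (c + suc a) (suc a) n
    A = admissibleSets k (c + a) (suc a) n
    zero⁻ : ∀ {I} → I ∈ Z → ZeroResidue k (c + suc a) (suc a) n I
    zero⁻ = ∈-zeroResidueSets⁻ k (c + suc a) (suc a) n
    admissible⁻ : ∀ {I} → I ∈ A → Admissible k (c + a) (suc a) n I
    admissible⁻ = ∈-admissibleSets⁻ k (c + a) (suc a) n (<⇒≤ k<r)
    zero-avoids : ∀ {I J} → I ∈ Z → KSubset k (suc a) n J → I ≢ J → FaceAvoids c (suc a ∷ I) (suc a ∷ J)
    zero-avoids {I} I∈ J⊂ =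
      zeroResidue-∷-avoids (proj₁ (zero⁻ I∈)) J⊂ (trans (residue-∷ c (suc a) I) (proj₂ (zero⁻ I∈)))
    zero≢admissible : ∀ {I J} → I ∈ Z → J ∈ A → I ≢ J
    zero≢admissible {I} I∈ J∈ refl =
      0≢1+n (trans (sym (trans (residue-∷ c (suc a) I) (proj₂ (zero⁻ I∈))))
                   (residue-∷-< c a I k<r (proj₂ (admissible⁻ J∈))))
    through-1+a : AllPairs (λ I J → FaceAvoids c (suc a ∷ I) (suc a ∷ J)) (Z ++ A)
    through-1+a = AllPairsₚ.++⁺
      (AllPairs-map-∈ (λ I∈ J∈ → zero-avoids I∈ (proj₁ (zero⁻ J∈))) (zeroResidueSets-unique k (c + suc a) (suc a) n))
      (AllPairs-map-∈ (λ I∈ _ → admissible-∷-avoids _ k<r (admissible⁻ I∈))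
                      (admissibleSets-shelling k (c + a) (suc a) n (<⇒≤ k<r) bound))
      (All.tabulate λ I∈ → All.tabulate λ J∈ → zero-avoids I∈ (proj₁ (admissible⁻ J∈)) (zero≢admissible I∈ J∈))
    crossing : ∀ {I J} → I ∈ admissibleSets (suc k) c (suc a) n → J ∈ map (suc a ∷_) (Z ++ A) → FaceAvoids c I J
    crossing I∈ J∈ with ∈-map⁻ (suc a ∷_) J∈
    ... | _ , _ , refl = admissible-crossing bound (∈-admissibleSets⁻ (suc k) c (suc a) n k<r I∈)
                           (∈-admissibleSets⁻ (suc k) c a (suc n) k<r (∈-++⁺ʳ (admissibleSets (suc k) c (suc a) n) J∈))

module HyperedgesOfΓ (r d k : ℕ) .{{_ : NonZero r}} .{{_ : NonZero d}} (k≤r : k ≤ r)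
                     (js : List ℕ) (|js| : length js ≡ r ∸ k) (js↑ : Increasing js)
                     (js-bounds : All (λ j → r + 1 ≤ j × j ≤ r * d) js) where
  open Shelling r

  C : ℕ
  C = sum js

  prefixes : List (List ℕ)
  prefixes = admissibleSets k C 0 r

  edges : List (List ℕ)
  edges = map (_++ js) prefixes

  r<js : All (r <_) js
  r<js = All.map (λ (r+1≤j , _) → ≤-trans (≤-reflexive (+-comm 1 r)) r+1≤j) js-bounds

  prefixes-admissible : All (Admissible k C 0 r) prefixes
  prefixes-admissible = All.tabulate (∈-admissibleSets⁻ k C 0 r k≤r)

  prefixes-shelling : AllPairs (FaceAvoids C) prefixes
  prefixes-shelling = admissibleSets-shelling k C 0 r k≤r ≤-refl

  residue≡sum%r : ∀ I → residue C I ≡ sum (I ++ js) % r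
  residue≡sum%r I = cong (_% r) (sym (sum-++ I js))

  edges-unique : Unique edges
  edges-unique = Unique.map⁺ (++-cancelʳ js _ _) (AllPairs.map FaceAvoids⇒≢ prefixes-shelling)

  admissible⇒GammaEdge : ∀ {I} → Admissible k C 0 r I → GammaEdge r d k js (I ++ js)
  admissible⇒GammaEdge {I} ((I↑ , I≤r , |I|) , t<k) =
    I , |I| , Linked.tail I↑ , I-bounds , refl ,
    (|I++js| , I++js↑ , I++js-bounds , index++ I js t t<|I| , (sum (I ++ js) / r , sum≡) , lookup-bounds)
    where
    t = residue C I
    t<|I| : t < length I
    t<|I| = subst (t <_) (sym |I|) t<k
    I-bounds : All (λ i → 1 ≤ i × i ≤ r) I
    I-bounds = All.zip (Increasing⇒All I↑ , I≤r)
    |I++js| : length (I ++ js) ≡ r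
    |I++js| = trans (length-++ I) (trans (cong₂ _+_ |I| |js|) (m+[n∸m]≡n k≤r))
    I++js↑ : Increasing (I ++ js)
    I++js↑ = AllPairs⇒Linked (AllPairsₚ.++⁺ (Linked⇒AllPairs <-trans (Linked.tail I↑)) (Linked⇒AllPairs <-trans js↑)
               (All.map (λ i≤r → All.map (≤-<-trans i≤r) r<js) I≤r))
    I++js-bounds : All (λ i → 1 ≤ i × i ≤ r * d) (I ++ js)
    I++js-bounds = Allₚ.++⁺ (All.map (λ (1≤i , i≤r) → 1≤i , ≤-trans i≤r (m≤m*n r d)) I-bounds)
                           (All.map (λ (r+1≤j , j≤rd) → ≤-trans (m≤n+m 1 r) r+1≤j , j≤rd) js-bounds)
    sum≡ : sum (I ++ js) ≡ sum (I ++ js) / r * r + toℕ (index++ I js t t<|I|)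
    sum≡ = begin
      sum (I ++ js)                              ≡⟨ m≡m%n+[m/n]*n (sum (I ++ js)) r ⟩
      sum (I ++ js) % r + sum (I ++ js) / r * r  ≡⟨ +-comm (sum (I ++ js) % r) _ ⟩
      sum (I ++ js) / r * r + sum (I ++ js) % r  ≡⟨ cong (sum (I ++ js) / r * r +_) (sym (residue≡sum%r I)) ⟩
      sum (I ++ js) / r * r + t                  ≡⟨ cong (sum (I ++ js) / r * r +_) (toℕ-index++ I js t t<|I|) ⟨
      sum (I ++ js) / r * r + toℕ (index++ I js t t<|I|) ∎
      where open ≡-Reasoning
    lookup-bounds : 1 ≤ lookup (I ++ js) (index++ I js t t<|I|) × lookup (I ++ js) (index++ I js t t<|I|) ≤ r
    lookup-bounds = subst (λ i → 1 ≤ i × i ≤ r) (sym (lookup-index++ I js t t<|I|)) (All.lookup I-bounds (elemAt-∈ t I t<|I|))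

  GammaEdge⇒∈edges : ∀ {τ} → GammaEdge r d k js τ → τ ∈ edges
  GammaEdge⇒∈edges (I , |I| , I↑ , I-bounds , refl , |τ| , _ , _ , i , (q , sum≡) , _ , τᵢ≤r) =
    ∈-map⁺ (_++ js) (∈-admissibleSets⁺ k C 0 r
      ((All⇒Increasing (All.map proj₁ I-bounds) I↑ , All.map proj₂ I-bounds , |I|) , residue<k))
    where
    residue≡i : residue C I ≡ toℕ i
    residue≡i = begin
      residue C I          ≡⟨ residue≡sum%r I ⟩
      sum (I ++ js) % r    ≡⟨ cong (_% r) (trans sum≡ (+-comm (q * r) (toℕ i))) ⟩
      (toℕ i + q * r) % r  ≡⟨ [m+kn]%n≡m%n (toℕ i) q r ⟩
      toℕ i % r            ≡⟨ m<n⇒m%n≡m (subst (toℕ i <_) |τ| (toℕ<n i)) ⟩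
      toℕ i                ∎
      where open ≡-Reasoning
    residue<k : residue C I < k
    residue<k with index++-split I js i
    ... | inj₁ i<|I| = subst₂ _<_ (sym residue≡i) |I| i<|I|
    ... | inj₂ τᵢ∈js = ⊥-elim (<⇒≱ (All.lookup r<js τᵢ∈js) τᵢ≤r)

  ∈edges⇔GammaEdge : ∀ τ → (τ ∈ edges) ⇔ GammaEdge r d k js τ
  ∈edges⇔GammaEdge τ = mk⇔ ∈edges⇒GammaEdge GammaEdge⇒∈edges
    where
    ∈edges⇒GammaEdge : τ ∈ edges → GammaEdge r d k js τ
    ∈edges⇒GammaEdge τ∈ with ∈-map⁻ (_++ js) τ∈
    ... | _ , I∈ , refl = admissible⇒GammaEdge (All.lookup prefixes-admissible I∈)

  freeFace : ∀ {I Z} → Admissible k C 0 r I → All (FaceAvoids C I) Z →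
             FreeFace js (I ++ js) ((I ++ js) ∷ map (_++ js) Z)
  freeFace {I} {Z} ((_ , I≤r , |I|) , t<k) avoids = index++ I js t t<|I| , js⊆ , free
    where
    t = residue C I
    t<|I| : t < length I
    t<|I| = subst (t <_) (sym |I|) t<k
    removeAt≡ : removeAt (I ++ js) (index++ I js t t<|I|) ≡ face C I ++ js
    removeAt≡ = removeAt-index++ I js t t<|I|
    js⊆ : js ⊆ removeAt (I ++ js) (index++ I js t t<|I|)
    js⊆ j∈ = subst (_ ∈_) (sym removeAt≡) (∈-++⁺ʳ (face C I) j∈)
    free : ∀ {σ} → σ ∈ (I ++ js) ∷ map (_++ js) Z → removeAt (I ++ js) (index++ I js t t<|I|) ⊆ σ → σ ≡ I ++ js
    free (here σ≡) _ = σ≡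
    free (there σ∈) face⊆σ with ∈-map⁻ (_++ js) σ∈
    ... | J , J∈ , refl = ⊥-elim (All.lookup avoids J∈ face⊆J)
      where
      face⊆J : face C I ⊆ J
      face⊆J y∈ with ∈-++⁻ J (face⊆σ (subst (_ ∈_) (sym removeAt≡) (∈-++⁺ˡ y∈)))
      ... | inj₁ y∈J = y∈J
      ... | inj₂ y∈js = ⊥-elim (<⇒≱ (All.lookup r<js y∈js) (All.lookup I≤r (deleteAt-⊆ t I y∈)))

  leafChain : ∀ {Z} → All (Admissible k C 0 r) Z → AllPairs (FaceAvoids C) Z → LeafChain js (map (_++ js) Z)
  leafChain [] [] = []
  leafChain (admissible ∷ admissibles) (avoids ∷ avoidss) = freeFace admissible avoids ∷ leafChain admissibles avoidss

lemma4p9 : (r d k : ℕ) → 1 ≤ r → 1 ≤ d → 1 ≤ k → k ≤ r →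
    (js : List ℕ) → length js ≡ r ∸ k → Linked _<_ js →
    All (λ j → r + 1 ≤ j × j ≤ r * d) js →
    Σ (List (List ℕ)) (λ es →
      Unique es × (∀ τ → (τ ∈ es) ⇔ GammaEdge r d k js τ) × LeafChain js es)
lemma4p9 r@(suc _) d@(suc _) k _ _ _ k≤r js |js| js↑ js-bounds =
  edges , edges-unique , ∈edges⇔GammaEdge , leafChain prefixes-admissible prefixes-shelling
  where open HyperedgesOfΓ r d k k≤r js |js| js↑ js-bounds
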